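{- Let $N$ be a complete network, $\mathcal{R}$ its set of root components, and $W_0$ the set of nodes forming trivial (single-node) root components. For $T\in\mathcal{R}$, let $W_1(T)$ be the set of nodes $u$ of $T$ that are adjacent to a node of $V_{DP}(N)$, satisfy $\deg_u(u,N)=1$, and have no tree child in $N$. Then $N$ is weakly tree-child if and only if every non-leaf node in $V_{DP}(N)\cup W_0$ (i.e. every such node with at least one child) has a tree child in $N$ and $|W_1(T)|\le 1$ for every $T\in\mathcal{R}$. Likewise, $N$ is strongly tree-child if and only if every non-leaf node in $V_{DP}(N)\cup W_0$ has a tree child in $N$ and $W_1(T)=\emptyset$ for every $T\in\mathcal{R}$.
   Context: A semidirected graph is $N=(V,E)$ with $E=E_U\sqcup E_D$, $E_U$ undirected edges $uv$, $E_D$ directed edges $(u,v)$ ($u$ parent, $v$ child); parallel directed edges allowed, no self-loops. $\deg_i(v,N)$ is the number of directed edges with child $v$, $\deg_u(v,N)$ the number of undirected edges incident to $v$. A child of $v$ in $N$ is a node $w$ with $(v,w)\in E_D$ (children are defined using directed edges only); a tree child is a child that is a tree node. $N'$ is compatible with $N$ if obtained by directing some undirected edges. A semidirected cycle is a semidirected graph whose undirected edges can be directed to make it a directed cycle; acyclic (SDAG) means containing no semidirected cycle; DAG = acyclic directed graph. Tree node: $\deg_i\le1$; hybrid node otherwise. Hybrid edge: directed edge with hybrid child; $E_H(N)$ their set. SDAG $N'$ is phylogenetically compatible with SDAG $N$ if compatible and $E_H(N')=E_H(N)$; a rooted partner of $N$ is a DAG phylogenetically compatible with $N$; a network is an SDAG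 admitting a rooted partner. In a DAG, a leaf is a node of out-degree 0; a DAG is tree-child if every non-leaf node has at least one child that is a tree node. A network is weakly tree-child if at least one of its rooted partners is tree-child, and strongly tree-child if all its rooted partners are tree-child. A semidirected path from $u_0$ to $u_n$ is $u_0\dots u_n$ with $u_{i-1}u_i$ or $(u_{i-1},u_i)$ an edge for each $i$; $v\lesssim u$ if there is a semidirected path from $u$ to $v$; $u\sim v$ if $u\lesssim v$ and $v\lesssim u$. An undirected component is the subgraph induced by a $\sim$-class; a root component is one whose class is maximal under $\lesssim$; it is trivial if it has a single node. $V_{DP}(N)$ is the set of nodes not in any root component. Edges not in root components have the same direction in all rooted partners; the completion $\mathcal{C}(N)$ directs each undirected such edge accordingly, and $N$ is complete if $\mathcal{C}(N)=N$. -}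

module Defs where

open import Data.Nat using (ℕ; _≤_; _≤?_)
open import Data.Bool using (Bool; true; false)
open import Data.Fin using (Fin) renaming (_≟_ to _≟ᶠ_)
open import Data.Product using (Σ; ∃; _×_; _,_; proj₁; proj₂; swap)
open import Data.Sum using (_⊎_; inj₁; inj₂)
open import Data.Empty using (⊥)
open import Data.List using (List; []; _∷_; _++_; length; filter; tabulate; lookup)
open import Data.List.Membership.Propositional using (_∈_)
open import Data.List.Relation.Unary.Any using (index)
open import Data.List.Relation.Unary.AllPairs using (AllPairs)
open import Data.List.Relation.Unary.Unique.Propositional using (Unique)
open import Data.List.Relation.Binary.Permutation.Propositional using (_↭_)
open import Relation.Binary.Construct.Closure.ReflexiveTransitive using (Star; ε; _◅_)
open import Relation.Binary.PropositionalEquality using (_≡_; _≢_)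
open import Relation.Nullary using (¬_)
open import Relation.Nullary.Decidable using (_⊎-dec_)

-- EU : undirected edges, an undirected edge uv stored as a pair (u , v)
--      (orientation of the stored pair is irrelevant);
-- ED : directed edges (u , v) with u the parent and v the child
--      (a list, so parallel directed edges are allowed).

record SDG (n : ℕ) : Set where
  field
    EU : List (Fin n × Fin n)
    ED : List (Fin n × Fin n)
open SDG public

module _ {n : ℕ} where

  WellFormed : SDG n → Set
  WellFormed N =
    (∀ u v → (u , v) ∈ EU N → u ≢ v) ×
    (∀ u v → (u , v) ∈ ED N → u ≢ v) ×
    AllPairs (λ e f → e ≢ f × e ≢ swap f) (EU N)

  indeg : SDG n → Fin n → ℕ
  indeg N v = length (filter (λ e → proj₂ e ≟ᶠ v) (ED N))

  udeg : SDG n → Fin n → ℕ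
  udeg N v = length (filter (λ e → (proj₁ e ≟ᶠ v) ⊎-dec (proj₂ e ≟ᶠ v)) (EU N))

  IsTreeNode : SDG n → Fin n → Set
  IsTreeNode N v = indeg N v ≤ 1

  IsHybridNode : SDG n → Fin n → Set
  IsHybridNode N v = ¬ (indeg N v ≤ 1)

  hybridEdges : SDG n → List (Fin n × Fin n)
  hybridEdges N = filter (λ e → Relation.Nullary.¬? (indeg N (proj₂ e) ≤? 1)) (ED N)

  IsChild : SDG n → Fin n → Fin n → Set
  IsChild N v w = (v , w) ∈ ED N

  HasChild : SDG n → Fin n → Set
  HasChild N v = ∃ λ w → IsChild N v w

  HasTreeChild : SDG n → Fin n → Set
  HasTreeChild N v = ∃ λ w → IsChild N v w × IsTreeNode N w

  Adjacent : SDG n → Fin n → Fin n → Set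
  Adjacent N u v = (u , v) ∈ ED N ⊎ (v , u) ∈ ED N ⊎ (u , v) ∈ EU N ⊎ (v , u) ∈ EU N

  data SStep (N : SDG n) : Fin n → Fin n → Set where
    dstep  : ∀ {u v} → (u , v) ∈ ED N → SStep N u v
    ustep₁ : ∀ {u v} → (u , v) ∈ EU N → SStep N u v
    ustep₂ : ∀ {u v} → (v , u) ∈ EU N → SStep N u v

  EdgeId : SDG n → Set
  EdgeId N = Fin (length (ED N)) ⊎ Fin (length (EU N))

  edgeId : ∀ {N u v} → SStep N u v → EdgeId N
  edgeId (dstep p)  = inj₁ (index p)
  edgeId (ustep₁ p) = inj₂ (index p)
  edgeId (ustep₂ p) = inj₂ (index p)

  SPath : SDG n → Fin n → Fin n → Set
  SPath N = Star (SStep N)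

  pathEdges : ∀ {N u v} → SPath N u v → List (EdgeId N)
  pathEdges ε        = []
  pathEdges (s ◅ p)  = edgeId s ∷ pathEdges p

  pathNodes : ∀ {N u v} → SPath N u v → List (Fin n)
  pathNodes ε                 = []
  pathNodes (_◅_ {i = u} s p) = u ∷ pathNodes p

  -- A semidirected cycle in N: a closed semidirected path of positive
  -- length with pairwise distinct edges and pairwise distinct nodes
  -- (i.e. a cycle subgraph whose undirected edges can be directed to
  -- form a directed cycle).
  IsSemidirectedCycle : (N : SDG n) (u : Fin n) → SPath N u u → Set
  IsSemidirectedCycle N u ε       = ⊥
  IsSemidirectedCycle N u (s ◅ p) =
    Unique (pathEdges (s ◅ p)) × Unique (pathNodes (s ◅ p))

  Acyclic : SDG n → Set
  Acyclic N = ∀ u (p : SPath N u u) → ¬ IsSemidirectedCycle N u p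

  IsDAG : SDG n → Set
  IsDAG N = EU N ≡ [] × Acyclic N

  orientEdge : Bool → Fin n × Fin n → Fin n × Fin n
  orientEdge true  e = e
  orientEdge false e = swap e

  orientAll : (N : SDG n) → (Fin (length (EU N)) → Bool) → SDG n
  orientAll N σ = record
    { EU = []
    ; ED = ED N ++ tabulate (λ i → orientEdge (σ i) (lookup (EU N) i)) }

  -- A rooted partner of N: a DAG phylogenetically compatible with N,
  -- i.e. a DAG compatible with N (all undirected edges directed, since a
  -- DAG has no undirected edges) with the same hybrid edges (as multisets).
  IsRootedPartnerOrientation : (N : SDG n) → (Fin (length (EU N)) → Bool) → Set
  IsRootedPartnerOrientation N σ =
    IsDAG (orientAll N σ) × hybridEdges (orientAll N σ) ↭ hybridEdges N

  IsNetwork : SDG n → Set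
  IsNetwork N = WellFormed N × Acyclic N × ∃ (IsRootedPartnerOrientation N)

  IsTreeChild : SDG n → Set
  IsTreeChild D = ∀ v → HasChild D v → HasTreeChild D v

  WeaklyTreeChild : SDG n → Set
  WeaklyTreeChild N =
    ∃ λ σ → IsRootedPartnerOrientation N σ × IsTreeChild (orientAll N σ)

  StronglyTreeChild : SDG n → Set
  StronglyTreeChild N =
    ∀ σ → IsRootedPartnerOrientation N σ → IsTreeChild (orientAll N σ)

  _≲⟨_⟩_ : Fin n → SDG n → Fin n → Set
  v ≲⟨ N ⟩ u = SPath N u v

  _∼⟨_⟩_ : Fin n → SDG n → Fin n → Set
  u ∼⟨ N ⟩ v = (u ≲⟨ N ⟩ v) × (v ≲⟨ N ⟩ u)

  -- u lies in a root component: its ∼-class is maximal under ≲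
  InRootComponent : SDG n → Fin n → Set
  InRootComponent N u = ∀ w → u ≲⟨ N ⟩ w → w ≲⟨ N ⟩ u

  InVDP : SDG n → Fin n → Set
  InVDP N u = ¬ InRootComponent N u

  InW₀ : SDG n → Fin n → Set
  InW₀ N u = InRootComponent N u × (∀ w → w ∼⟨ N ⟩ u → w ≡ u)

  -- N is complete: C(N) = N, i.e. no undirected edge lies outside the
  -- root components (every undirected edge has both endpoints in one
  -- root component).
  Complete : SDG n → Set
  Complete N = ∀ u v → (u , v) ∈ EU N →
    InRootComponent N u × InRootComponent N v × u ∼⟨ N ⟩ v

  -- W₁(T) for the root component T containing the node r
  InW₁ : SDG n → Fin n → Fin n → Set
  InW₁ N r u =
    u ∼⟨ N ⟩ r ×
    (∃ λ w → Adjacent N u w × InVDP N w) ×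
    udeg N u ≡ 1 ×
    ¬ HasTreeChild N u

module Submission where

open import Defs
open import Data.Nat using (ℕ; zero; suc; _≤_; _<_; _+_; z≤n; s≤s; _≤?_)
open import Data.Nat.Properties
  using (≤-refl; ≤-reflexive; ≤-trans; ≤-antisym; ≤-pred; <⇒≱; ≰⇒>; n≤1+n; m≤m+n; +-identityʳ; +-suc;
         module ≤-Reasoning)
open import Data.Bool using (Bool; true; false; not; if_then_else_)
open import Data.Fin using (Fin; zero; suc; _≟_)
open import Data.Fin.Properties using (0≢1+n; suc-injective; pigeonhole; <-irrefl; any?)
open import Data.Product using (Σ; ∃; _×_; _,_; proj₁; proj₂; swap)
open import Data.Product.Properties using (≡-dec)
open import Data.Sum using (_⊎_; inj₁; inj₂; [_,_]′)
import Data.Sum as Sum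
open import Data.Unit using (⊤; tt)
open import Data.Empty using (⊥-elim)
open import Data.List using (List; []; _∷_; _++_; length; filter; tabulate; lookup; allFin)
open import Data.List.Properties
  using (filter-none; filter-some; filter-accept; filter-++; filter-≐; length-++; ++-identityʳ; tabulate-lookup)
open import Data.List.Membership.Propositional using (_∈_; _∉_; find)
open import Data.List.Membership.Propositional.Properties
  using (∈-lookup; ∈-++⁻; ∈-++⁺ˡ; ∈-++⁺ʳ; ∈-tabulate⁺; ∈-tabulate⁻; ∈-filter⁺; ∈-filter⁻; ∈-allFin)
import Data.List.Membership.DecPropositional as DecMembership
open import Data.List.Relation.Unary.Any using (Any; here; there; index)
open import Data.List.Relation.Unary.Any.Properties using (lookup-index; tabulate⁺; tabulate⁻)
open import Data.List.Relation.Unary.All using (All; []; _∷_)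
import Data.List.Relation.Unary.All as All
open import Data.List.Relation.Unary.All.Properties.Core using (¬Any⇒All¬)
open import Data.List.Relation.Unary.AllPairs using ([]; _∷_)
open import Data.List.Relation.Unary.Unique.Propositional using (Unique)
open import Data.List.Relation.Binary.Subset.Propositional using (_⊆_)
open import Data.List.Relation.Binary.Permutation.Propositional using (_↭_; ↭-reflexive)
open import Data.List.Relation.Binary.Permutation.Propositional.Properties using (∈-resp-↭)
open import Function using (id; _∘_)
open import Function.Bundles using (_⇔_; mk⇔)
open import Relation.Binary.Construct.Closure.ReflexiveTransitive using (Star; ε; _◅_; _◅◅_)
import Relation.Binary.Construct.Closure.ReflexiveTransitive as Star
open import Relation.Binary.Definitions using (DecidableEquality)
open import Relation.Binary.PropositionalEquality
  using (_≡_; _≢_; refl; sym; trans; cong; subst; module ≡-Reasoning)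
open import Relation.Nullary using (¬_; ¬?; Dec; yes; no; does; contradiction)
open import Relation.Nullary.Decidable using (dec-true; _×-dec_; _⊎-dec_)
open import Relation.Unary using (Decidable; _≐_)

-- Every undirected edge of a complete network lies in a root component, and no directed edge enters a root
-- component, so a rooted partner is exactly an orientation of these edges under which every node receives at
-- most one arc; acyclicity of the orientation is inherited from N. When every non-leaf node of V_DP ∪ W₀ has a
-- tree child, a node can only violate tree-childness of such an orientation if it is "blocked": it receives an
-- arc, sends none, and has children in N but no tree child. Blocked nodes are exactly the nodes of W₁ that
-- receive an arc. A node of W₁ has a single undirected edge, so some rooted partner directs it into the node:
-- W₁ must be empty for strong tree-childness. Inside a root component every node except the unique source
-- receives an arc, so two nodes of W₁(T) cannot both be unblocked. Conversely, when |W₁(T)| ≤ 1, reversing the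
-- arcs on the path from the source of T to its blocked node unblocks that node without blocking any other, and
-- doing this for every node yields a tree-child partner.

count : ∀ {A : Set} {P : A → Set} → Decidable P → List A → ℕ
count P? xs = length (filter P? xs)

AtMostOne : ∀ {m} → (Fin m → Set) → Set
AtMostOne Q = ∀ {i j} → Q i → Q j → i ≡ j

module _ {A : Set} {P : A → Set} (P? : Decidable P) where

  ¬Any⇒count≡0 : ∀ {xs} → ¬ Any P xs → count P? xs ≡ 0
  ¬Any⇒count≡0 ¬any = cong length (filter-none P? (¬Any⇒All¬ _ ¬any))

  count>0⇒Any : ∀ {xs} → 0 < count P? xs → Any P xs
  count>0⇒Any {x ∷ xs} h with P? x
  ... | yes px = here px
  ... | no _   = there (count>0⇒Any h)

  count-∷-≤ : ∀ x xs → count P? xs ≤ count P? (x ∷ xs)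
  count-∷-≤ x xs with P? x
  ... | yes _ = n≤1+n _
  ... | no _  = ≤-refl

  AtMostOne⇒count≤1 : ∀ {m} (f : Fin m → A) → AtMostOne (λ i → P (f i)) → count P? (tabulate f) ≤ 1
  AtMostOne⇒count≤1 {zero}  f _   = z≤n
  AtMostOne⇒count≤1 {suc m} f one with P? (f zero)
  ... | yes p = s≤s (≤-reflexive (¬Any⇒count≡0 {tabulate (λ i → f (suc i))} λ any →
                  0≢1+n (one p (proj₂ (tabulate⁻ any)))))
  ... | no _  = AtMostOne⇒count≤1 (λ i → f (suc i)) (λ p q → suc-injective (one p q))

  count≤1⇒AtMostOne : ∀ {m} (f : Fin m → A) → count P? (tabulate f) ≤ 1 → AtMostOne (λ i → P (f i))
  count≤1⇒AtMostOne f h {zero}  {zero}  p q = refl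
  count≤1⇒AtMostOne f h {zero}  {suc j} p q =
    contradiction (≤-pred (subst (_≤ 1) (cong length (filter-accept P? p)) h))
                  (<⇒≱ (filter-some P? (tabulate⁺ j q)))
  count≤1⇒AtMostOne f h {suc i} {zero}  p q = sym (count≤1⇒AtMostOne f h q p)
  count≤1⇒AtMostOne f h {suc i} {suc j} p q =
    cong suc (count≤1⇒AtMostOne (λ k → f (suc k)) (≤-trans (count-∷-≤ (f zero) _) h) p q)

Unique-lookup-injective : ∀ {A : Set} {xs : List A} → Unique xs → ∀ {i j} → lookup xs i ≡ lookup xs j → i ≡ j
Unique-lookup-injective {xs = _ ∷ _} (_  ∷ _) {zero}  {zero}  _ = refl
Unique-lookup-injective {xs = _ ∷ _} (x∉ ∷ _) {zero}  {suc j} e = ⊥-elim (All.lookup x∉ (∈-lookup j) e)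
Unique-lookup-injective {xs = _ ∷ _} (x∉ ∷ _) {suc i} {zero}  e = ⊥-elim (All.lookup x∉ (∈-lookup i) (sym e))
Unique-lookup-injective {xs = _ ∷ _} (_  ∷ u) {suc i} {suc j} e = cong suc (Unique-lookup-injective u e)

Unique⇒length≤ : ∀ {n} {xs : List (Fin n)} → Unique xs → length xs ≤ n
Unique⇒length≤ {n} {xs} u with length xs ≤? n
... | yes p = p
... | no ¬p with pigeonhole (≰⇒> ¬p) (lookup xs)
...   | i , j , i<j , e = ⊥-elim (<-irrefl (Unique-lookup-injective u e) i<j)

index-∈-lookup : ∀ {A : Set} {xs : List A} i → index (∈-lookup {xs = xs} i) ≡ i
index-∈-lookup {xs = _ ∷ _} zero    = refl
index-∈-lookup {xs = _ ∷ _} (suc i) = cong suc (index-∈-lookup i)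

module _ {A : Set} {R : A → A → Set} where

  starts : ∀ {a b} → Star R a b → List A
  starts ε                 = []
  starts (_◅_ {i = a} _ p) = a ∷ starts p

  nodes : ∀ {a b} → Star R a b → List A
  nodes {b = b} ε         = b ∷ []
  nodes (_◅_ {i = a} _ p) = a ∷ nodes p

  Simple : ∀ {a b} → Star R a b → Set
  Simple ε                 = ⊤
  Simple (_◅_ {i = a} _ p) = a ∉ nodes p × Simple p

  first∈nodes : ∀ {a b} (p : Star R a b) → a ∈ nodes p
  first∈nodes ε       = here refl
  first∈nodes (_ ◅ _) = here refl

  last∈nodes : ∀ {a b} (p : Star R a b) → b ∈ nodes p
  last∈nodes ε       = here refl
  last∈nodes (_ ◅ p) = there (last∈nodes p)

  starts⊆nodes : ∀ {a b} (p : Star R a b) → starts p ⊆ nodes p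
  starts⊆nodes (_ ◅ p) (here e)  = here e
  starts⊆nodes (_ ◅ p) (there m) = there (starts⊆nodes p m)

  last∉starts : ∀ {a b} (p : Star R a b) → Simple p → b ∉ starts p
  last∉starts (_ ◅ p) (a∉ , _) (here refl) = a∉ (last∈nodes p)
  last∉starts (_ ◅ p) (_ , sp) (there m)   = last∉starts p sp m

  Simple⇒Unique-nodes : ∀ {a b} (p : Star R a b) → Simple p → Unique (nodes p)
  Simple⇒Unique-nodes ε       _         = [] ∷ []
  Simple⇒Unique-nodes (_ ◅ p) (a∉ , sp) = ¬Any⇒All¬ _ a∉ ∷ Simple⇒Unique-nodes p sp

  Simple⇒Unique-starts : ∀ {a b} (p : Star R a b) → Simple p → Unique (starts p)
  Simple⇒Unique-starts ε       _         = []
  Simple⇒Unique-starts (_ ◅ p) (a∉ , sp) = ¬Any⇒All¬ _ (a∉ ∘ starts⊆nodes p) ∷ Simple⇒Unique-starts p sp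

  close-Unique-starts : ∀ {a b} (s : R b a) (p : Star R a b) → Simple p → Unique (starts (s ◅ p))
  close-Unique-starts s p sp = ¬Any⇒All¬ _ (last∉starts p sp) ∷ Simple⇒Unique-starts p sp

  suffix : ∀ {a c b} (p : Star R c b) → Simple p → a ∈ nodes p → Σ (Star R a b) Simple
  suffix ε       _        (here refl) = ε , tt
  suffix (s ◅ p) sp       (here refl) = s ◅ p , sp
  suffix (_ ◅ p) (_ , sp) (there m)   = suffix p sp m

  prefix : ∀ {a c b} (p : Star R c b) → Simple p → a ∈ nodes p →
           Σ (Star R c a) λ q → Simple q × nodes q ⊆ nodes p
  prefix ε       _         (here refl) = ε , tt , id
  prefix (_ ◅ _) _         (here refl) = ε , tt , λ { (here e) → here e }
  prefix (s ◅ p) (c∉ , sp) (there m)   with prefix p sp m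
  ... | q , sq , q⊆p = s ◅ q , (c∉ ∘ q⊆p , sq) , λ { (here e) → here e ; (there m) → there (q⊆p m) }

  simplify : DecidableEquality A → ∀ {a b} → Star R a b → Σ (Star R a b) Simple
  simplify _≟ₐ_ ε = ε , tt
  simplify _≟ₐ_ (_◅_ {i = a} s p) with simplify _≟ₐ_ p
  ... | q , sq with a ∈? nodes q
    where open DecMembership _≟ₐ_ using (_∈?_)
  ...   | yes a∈ = suffix q sq a∈
  ...   | no a∉  = s ◅ q , a∉ , sq

starts-map : ∀ {A : Set} {R R′ : A → A → Set} (g : ∀ {x y} → R x y → R′ x y) {a b} (p : Star R a b) →
             starts (Star.map g p) ≡ starts p
starts-map g ε                 = refl
starts-map g (_◅_ {i = a} s p) = cong (a ∷_) (starts-map g p)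

pathNodes≡starts : ∀ {n} {N : SDG n} {a b} (p : SPath N a b) → pathNodes p ≡ starts p
pathNodes≡starts ε                 = refl
pathNodes≡starts (_◅_ {i = a} _ p) = cong (a ∷_) (pathNodes≡starts p)

Joins : ∀ {n} → Fin n × Fin n → Fin n → Fin n → Set
Joins e x z = e ≡ (x , z) ⊎ e ≡ (z , x)

Incident : ∀ {n} → Fin n → Fin n × Fin n → Set
Incident v e = proj₁ e ≡ v ⊎ proj₂ e ≡ v

module _ {n} (P : Fin n → Set) {e : Fin n × Fin n} {x z : Fin n} where

  Joins⇒endpoints : Joins e x z → P x → P z → P (proj₁ e) × P (proj₂ e)
  Joins⇒endpoints (inj₁ refl) px pz = px , pz
  Joins⇒endpoints (inj₂ refl) px pz = pz , px

  endpoints⇒Joins : Joins e x z → P (proj₁ e) → P (proj₂ e) → P x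
  endpoints⇒Joins (inj₁ refl) px _ = px
  endpoints⇒Joins (inj₂ refl) _ px = px

Joins⇒Incident : ∀ {n} {e : Fin n × Fin n} {x z} → Joins e x z → Incident x e
Joins⇒Incident (inj₁ refl) = inj₁ refl
Joins⇒Incident (inj₂ refl) = inj₂ refl

Incident⇒Joins : ∀ {n} {v} {e : Fin n × Fin n} → Incident v e → ∃ λ c → Joins e v c
Incident⇒Joins {e = e} (inj₁ refl) = proj₂ e , inj₁ refl
Incident⇒Joins {e = e} (inj₂ refl) = proj₁ e , inj₂ refl

module _ {n : ℕ} where

  orientEdge-elim : (P : Fin n → Fin n → Set) → ∀ b e → P (proj₁ e) (proj₂ e) → P (proj₂ e) (proj₁ e) →
                    P (proj₁ (orientEdge b e)) (proj₂ (orientEdge b e))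
  orientEdge-elim P true  e p _ = p
  orientEdge-elim P false e _ p = p

  orientEdge-Joins : ∀ b {e : Fin n × Fin n} {x z} → Joins e x z → Joins (orientEdge b e) x z
  orientEdge-Joins true  j           = j
  orientEdge-Joins false (inj₁ refl) = inj₂ refl
  orientEdge-Joins false (inj₂ refl) = inj₁ refl

  orientEdge≡⇒Joins : ∀ b {e : Fin n × Fin n} {x z} → orientEdge b e ≡ (x , z) → Joins e x z
  orientEdge≡⇒Joins true  e≡ = inj₁ e≡
  orientEdge≡⇒Joins false e≡ = inj₂ (cong swap e≡)

  orientEdge-not : ∀ b (e : Fin n × Fin n) → orientEdge (not b) e ≡ swap (orientEdge b e)
  orientEdge-not true  e = refl
  orientEdge-not false e = refl

  orientEdge-Incident : ∀ b {e : Fin n × Fin n} {v} → Incident v (orientEdge b e) → Incident v e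
  orientEdge-Incident true  = id
  orientEdge-Incident false = Sum.swap

  orientEdge-Incident⁺ : ∀ b {e : Fin n × Fin n} {v} → Incident v e → Incident v (orientEdge b e)
  orientEdge-Incident⁺ true  = id
  orientEdge-Incident⁺ false = Sum.swap

Hybrid? : ∀ {n} (N : SDG n) → Decidable (λ (e : Fin n × Fin n) → ¬ IsTreeNode N (proj₂ e))
Hybrid? N e = ¬? (indeg N (proj₂ e) ≤? 1)

tree-node-resp-hybridEdges : ∀ {n} (A B : SDG n) → hybridEdges A ↭ hybridEdges B →
                             ∀ {w} → IsTreeNode B w → IsTreeNode A w
tree-node-resp-hybridEdges A B A≈B {w} w-tree-in-B with indeg A w ≤? 1
... | yes w-tree-in-A  = w-tree-in-A
... | no w-hybrid-in-A with find (count>0⇒Any (λ e → proj₂ e ≟ w) {ED A} (≤-trans (s≤s z≤n) (≰⇒> w-hybrid-in-A)))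
...   | e , e∈A , refl =
  contradiction w-tree-in-B (proj₂ (∈-filter⁻ (Hybrid? B) {xs = ED B}
                                      (∈-resp-↭ A≈B (∈-filter⁺ (Hybrid? A) e∈A w-hybrid-in-A))))

TreeChild-VDP∪W₀ : ∀ {n} → SDG n → Set
TreeChild-VDP∪W₀ N = ∀ v → InVDP N v ⊎ InW₀ N v → HasChild N v → HasTreeChild N v

W₁-AtMostOne : ∀ {n} → SDG n → Set
W₁-AtMostOne N = ∀ r → InRootComponent N r → ∀ u u′ → InW₁ N r u → InW₁ N r u′ → u ≡ u′

W₁-Empty : ∀ {n} → SDG n → Set
W₁-Empty N = ∀ r → InRootComponent N r → ∀ u → ¬ InW₁ N r u

-- Root components

module Network {n : ℕ} (N : SDG n) (no-loops : ∀ u v → (u , v) ∈ EU N → u ≢ v)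
               (acyclic : Acyclic N) (complete : Complete N) where

  endpoints : EdgeId N → Fin n × Fin n
  endpoints (inj₁ k) = lookup (ED N) k
  endpoints (inj₂ k) = lookup (EU N) k

  step-Joins : ∀ {x z} (s : SStep N x z) → Joins (endpoints (edgeId s)) x z
  step-Joins (dstep p)  = inj₁ (sym (lookup-index p))
  step-Joins (ustep₁ p) = inj₁ (sym (lookup-index p))
  step-Joins (ustep₂ p) = inj₂ (sym (lookup-index p))

  walk-edge-endpoints : ∀ {a b e} (q : SPath N a b) → e ∈ pathEdges q →
                        proj₁ (endpoints e) ∈ nodes q × proj₂ (endpoints e) ∈ nodes q
  walk-edge-endpoints (s ◅ q) (here refl) =
    Joins⇒endpoints (_∈ _) (step-Joins s) (here refl) (there (first∈nodes q))
  walk-edge-endpoints (s ◅ q) (there m)   = let m₁ , m₂ = walk-edge-endpoints q m in there m₁ , there m₂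

  Simple⇒Unique-edges : ∀ {a b} (q : SPath N a b) → Simple q → Unique (pathEdges q)
  Simple⇒Unique-edges ε       _         = []
  Simple⇒Unique-edges (s ◅ q) (a∉ , sq) = ¬Any⇒All¬ _ repeated ∷ Simple⇒Unique-edges q sq
    where
    repeated : edgeId s ∉ pathEdges q
    repeated m = let m₁ , m₂ = walk-edge-endpoints q m in a∉ (endpoints⇒Joins (_∈ _) (step-Joins s) m₁ m₂)

  directed-edge-tail∈starts : ∀ {a b k} (q : SPath N a b) → inj₁ k ∈ pathEdges q →
                              proj₁ (lookup (ED N) k) ∈ starts q
  directed-edge-tail∈starts (dstep p ◅ q) (here refl) = here (cong proj₁ (sym (lookup-index p)))
  directed-edge-tail∈starts (_ ◅ q)       (there m)   = there (directed-edge-tail∈starts q m)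

  root-no-parent : ∀ {u y} → InRootComponent N u → (y , u) ∉ ED N
  root-no-parent {u} {y} u-root y→u with simplify _≟_ (u-root y (dstep y→u ◅ ε))
  ... | q , sq = acyclic y (dstep y→u ◅ q) (edges-unique , nodes-unique)
    where
    edges-unique : Unique (inj₁ (index y→u) ∷ pathEdges q)
    edges-unique = ¬Any⇒All¬ _ (λ m → last∉starts q sq (subst (_∈ starts q) (cong proj₁ (sym (lookup-index y→u)))
                                                         (directed-edge-tail∈starts q m)))
                   ∷ Simple⇒Unique-edges q sq
    nodes-unique : Unique (y ∷ pathNodes q)
    nodes-unique = subst (λ l → Unique (y ∷ l)) (sym (pathNodes≡starts q)) (close-Unique-starts (dstep y→u) q sq)

  root-closed : ∀ {u x} → InRootComponent N u → SPath N x u → SPath N u x → InRootComponent N x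
  root-closed u-root x⇝u u⇝x w x⇝w = x⇝u ◅◅ u-root w (x⇝w ◅◅ x⇝u)

  ∼-trans : ∀ {x y z} → x ∼⟨ N ⟩ y → y ∼⟨ N ⟩ z → x ∼⟨ N ⟩ z
  ∼-trans (y⇝x , x⇝y) (z⇝y , y⇝z) = z⇝y ◅◅ y⇝x , x⇝y ◅◅ y⇝z

  UStep : Fin n → Fin n → Set
  UStep x z = ∃ λ k → Joins (lookup (EU N) k) x z

  root-walk⇒undirected : ∀ {a b} → InRootComponent N a → SPath N a b → SPath N b a → Star UStep a b
  root-walk⇒undirected a-root ε              _    = ε
  root-walk⇒undirected a-root (dstep e ◅ p)  back =
    ⊥-elim (root-no-parent (root-closed a-root (p ◅◅ back) (dstep e ◅ ε)) e)
  root-walk⇒undirected a-root (ustep₁ e ◅ p) back = (index e , inj₁ (sym (lookup-index e))) ◅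
    root-walk⇒undirected (root-closed a-root (p ◅◅ back) (ustep₁ e ◅ ε)) p (back ◅◅ (ustep₁ e ◅ ε))
  root-walk⇒undirected a-root (ustep₂ e ◅ p) back = (index e , inj₂ (sym (lookup-index e))) ◅
    root-walk⇒undirected (root-closed a-root (p ◅◅ back) (ustep₂ e ◅ ε)) p (back ◅◅ (ustep₂ e ◅ ε))

  edge : Fin (length (EU N)) → Fin n × Fin n
  edge = lookup (EU N)

  edge-in-root : ∀ k → InRootComponent N (proj₁ (edge k)) × InRootComponent N (proj₂ (edge k)) ×
                       proj₁ (edge k) ∼⟨ N ⟩ proj₂ (edge k)
  edge-in-root k = complete _ _ (∈-lookup k)

  UStep⇒∼ : ∀ {x z} → UStep x z → x ∼⟨ N ⟩ z
  UStep⇒∼ (k , inj₁ refl) = proj₂ (proj₂ (edge-in-root k))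
  UStep⇒∼ (k , inj₂ refl) = swap (proj₂ (proj₂ (edge-in-root k)))

  undirected⇒∼ : ∀ {x z} → Star UStep x z → x ∼⟨ N ⟩ z
  undirected⇒∼ ε       = ε , ε
  undirected⇒∼ (s ◅ p) = ∼-trans (UStep⇒∼ s) (undirected⇒∼ p)

  Incident-∼ : ∀ {v k u} → Incident v (edge k) → proj₁ (edge k) ∼⟨ N ⟩ u → v ∼⟨ N ⟩ u
  Incident-∼ (inj₁ refl) k∼u = k∼u
  Incident-∼ {k = k} (inj₂ refl) k∼u = ∼-trans (swap (proj₂ (proj₂ (edge-in-root k)))) k∼u

  root-indeg≡0 : ∀ {w} → InRootComponent N w → indeg N w ≡ 0
  root-indeg≡0 {w} w-root = ¬Any⇒count≡0 (λ e → proj₂ e ≟ w) λ any →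
    let e , e∈ , e→w = find any in root-no-parent w-root (subst (λ v → (proj₁ e , v) ∈ ED N) e→w e∈)

  root-tree : ∀ {w} → InRootComponent N w → IsTreeNode N w
  root-tree w-root = ≤-trans (≤-reflexive (root-indeg≡0 w-root)) z≤n

  -- Orientations of the undirected edges

  Orientation : Set
  Orientation = Fin (length (EU N)) → Bool

  arc : Orientation → Fin (length (EU N)) → Fin n × Fin n
  arc σ k = orientEdge (σ k) (edge k)

  tail head : Orientation → Fin (length (EU N)) → Fin n
  tail σ k = proj₁ (arc σ k)
  head σ k = proj₂ (arc σ k)

  Arc : Orientation → Fin n → Fin n → Set
  Arc σ x z = ∃ λ k → arc σ k ≡ (x , z)

  HasParentArc HasChildArc Source : Orientation → Fin n → Set
  HasParentArc σ v = ∃ λ k → head σ k ≡ v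
  HasChildArc  σ v = ∃ λ k → tail σ k ≡ v
  Source       σ v = ¬ HasParentArc σ v

  HeadInjective : Orientation → Set
  HeadInjective σ = ∀ w → AtMostOne (λ k → head σ k ≡ w)

  tail-root : ∀ σ k → InRootComponent N (tail σ k)
  tail-root σ k = orientEdge-elim (λ x _ → InRootComponent N x) (σ k) (edge k)
                    (proj₁ (edge-in-root k)) (proj₁ (proj₂ (edge-in-root k)))

  head-root : ∀ σ k → InRootComponent N (head σ k)
  head-root σ k = orientEdge-elim (λ _ z → InRootComponent N z) (σ k) (edge k)
                    (proj₁ (proj₂ (edge-in-root k))) (proj₁ (edge-in-root k))

  HasParentArc⇒root : ∀ σ {v} → HasParentArc σ v → InRootComponent N v
  HasParentArc⇒root σ (k , k→v) = subst (InRootComponent N) k→v (head-root σ k)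

  tail∼head : ∀ σ k → tail σ k ∼⟨ N ⟩ head σ k
  tail∼head σ k = orientEdge-elim (λ x z → x ∼⟨ N ⟩ z) (σ k) (edge k)
                    (proj₂ (proj₂ (edge-in-root k))) (swap (proj₂ (proj₂ (edge-in-root k))))

  tail≢head : ∀ σ k → tail σ k ≢ head σ k
  tail≢head σ k = orientEdge-elim (λ x z → x ≢ z) (σ k) (edge k)
                    (no-loops _ _ (∈-lookup k)) (λ e → no-loops _ _ (∈-lookup k) (sym e))

  Arc⇒UStep : ∀ {σ x z} → Arc σ x z → UStep x z
  Arc⇒UStep {σ} (k , k→) = k , orientEdge≡⇒Joins (σ k) k→

  orientAll-child⁻ : ∀ σ {v w} → IsChild (orientAll N σ) v w → IsChild N v w ⊎ Arc σ v w
  orientAll-child⁻ σ v→w with ∈-++⁻ (ED N) v→w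
  ... | inj₁ v→w∈N    = inj₁ v→w∈N
  ... | inj₂ v→w∈arcs = let k , e = ∈-tabulate⁻ v→w∈arcs in inj₂ (k , sym e)

  arc-child : ∀ σ k → IsChild (orientAll N σ) (tail σ k) (head σ k)
  arc-child σ k = ∈-++⁺ʳ (ED N) (∈-tabulate⁺ k)

  -- Each edge has a tail fixed by σ, so Forward walks through distinct nodes use distinct edges: this is
  -- how a cycle of orientAll N σ is turned into a semidirected cycle of N.
  start : Orientation → EdgeId N → Fin n
  start σ (inj₁ k) = proj₁ (lookup (ED N) k)
  start σ (inj₂ k) = tail σ k

  Forward : Orientation → Fin n → Fin n → Set
  Forward σ x z = Σ (SStep N x z) λ s → start σ (edgeId s) ≡ x

  forward-edge-start : ∀ {σ a b e} (q : Star (Forward σ) a b) → e ∈ pathEdges (Star.map proj₁ q) →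
                       start σ e ∈ starts q
  forward-edge-start ((_ , s≡) ◅ _) (here refl) = here s≡
  forward-edge-start (_ ◅ q)        (there m)   = there (forward-edge-start q m)

  forward-Unique-edges : ∀ {σ a b} (q : Star (Forward σ) a b) → Unique (starts q) →
                         Unique (pathEdges (Star.map proj₁ q))
  forward-Unique-edges ε              _        = []
  forward-Unique-edges ((_ , s≡) ◅ q) (a∉ ∷ u) =
    ¬Any⇒All¬ _ (λ m → All.lookup a∉ (subst (_∈ starts q) s≡ (forward-edge-start q m)) refl)
    ∷ forward-Unique-edges q u

  no-forward-cycle : ∀ {σ a b} (s : Forward σ a b) (q : Star (Forward σ) b a) → ¬ Unique (starts (s ◅ q))
  no-forward-cycle s q u = acyclic _ (Star.map proj₁ (s ◅ q))
    (forward-Unique-edges (s ◅ q) u ,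
     subst Unique (sym (trans (pathNodes≡starts (Star.map proj₁ (s ◅ q))) (starts-map proj₁ (s ◅ q)))) u)

  Arc⇒Forward : ∀ {σ x z} → Arc σ x z → Forward σ x z
  Arc⇒Forward {σ} (k , k→) = by-direction (σ k) refl k→
    where
    by-direction : ∀ b {x z} → σ k ≡ b → orientEdge b (edge k) ≡ (x , z) → Forward σ x z
    by-direction true  σk refl = ustep₁ (∈-lookup k) ,
      trans (cong (tail σ) (index-∈-lookup k)) (cong (λ b → proj₁ (orientEdge b (edge k))) σk)
    by-direction false σk refl = ustep₂ (∈-lookup k) ,
      trans (cong (tail σ) (index-∈-lookup k)) (cong (λ b → proj₁ (orientEdge b (edge k))) σk)

  orientAll-step⇒Forward : ∀ σ {x z} → SStep (orientAll N σ) x z → Forward σ x z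
  orientAll-step⇒Forward σ (dstep p) with orientAll-child⁻ σ p
  ... | inj₁ p∈N = dstep p∈N , cong proj₁ (sym (lookup-index p∈N))
  ... | inj₂ a   = Arc⇒Forward a

  orientAll-acyclic : ∀ σ → Acyclic (orientAll N σ)
  orientAll-acyclic σ u (s ◅ q) (_ , unique-nodes) =
    no-forward-cycle (to-Forward s) (Star.map to-Forward q)
      (subst Unique (trans (pathNodes≡starts (s ◅ q)) (sym (starts-map to-Forward (s ◅ q)))) unique-nodes)
    where
    to-Forward : ∀ {x z} → SStep (orientAll N σ) x z → Forward σ x z
    to-Forward = orientAll-step⇒Forward σ

  -- Rooted partners

  parent-arc-count : Orientation → Fin n → ℕ
  parent-arc-count σ w = count (λ e → proj₂ e ≟ w) (tabulate (arc σ))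

  indeg-orientAll : ∀ σ w → indeg (orientAll N σ) w ≡ indeg N w + parent-arc-count σ w
  indeg-orientAll σ w = trans (cong length (filter-++ (λ e → proj₂ e ≟ w) (ED N) (tabulate (arc σ))))
                              (length-++ (filter (λ e → proj₂ e ≟ w) (ED N)))

  indeg-orientAll-root : ∀ σ {w} → InRootComponent N w → indeg (orientAll N σ) w ≡ parent-arc-count σ w
  indeg-orientAll-root σ {w} w-root =
    trans (indeg-orientAll σ w) (cong (_+ parent-arc-count σ w) (root-indeg≡0 w-root))

  orientAll-tree⇒tree : ∀ σ {w} → IsTreeNode (orientAll N σ) w → IsTreeNode N w
  orientAll-tree⇒tree σ {w} t = ≤-trans (m≤m+n _ _) (subst (_≤ 1) (indeg-orientAll σ w) t)

  tree⇒orientAll-tree : ∀ σ → HeadInjective σ → ∀ {w} → IsTreeNode N w → IsTreeNode (orientAll N σ) w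
  tree⇒orientAll-tree σ inj {w} w-tree with any? (λ k → head σ k ≟ w)
  ... | yes parent = begin
    indeg (orientAll N σ) w ≡⟨ indeg-orientAll-root σ (HasParentArc⇒root σ parent) ⟩
    parent-arc-count σ w    ≤⟨ AtMostOne⇒count≤1 (λ e → proj₂ e ≟ w) (arc σ) (inj w) ⟩
    1                       ∎
    where open ≤-Reasoning
  ... | no source = begin
    indeg (orientAll N σ) w            ≡⟨ indeg-orientAll σ w ⟩
    indeg N w + parent-arc-count σ w   ≡⟨ cong (indeg N w +_) no-parent-arcs ⟩
    indeg N w + 0                      ≡⟨ +-identityʳ _ ⟩
    indeg N w                          ≤⟨ w-tree ⟩
    1                                  ∎
    where
    open ≤-Reasoning
    no-parent-arcs : parent-arc-count σ w ≡ 0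
    no-parent-arcs = ¬Any⇒count≡0 _ {tabulate (arc σ)} (source ∘ tabulate⁻)

  head-tree : ∀ σ → HeadInjective σ → ∀ k → IsTreeNode (orientAll N σ) (head σ k)
  head-tree σ inj k = tree⇒orientAll-tree σ inj (root-tree (head-root σ k))

  rooted-partner⇒HeadInjective : ∀ σ → IsRootedPartnerOrientation N σ → HeadInjective σ
  rooted-partner⇒HeadInjective σ (_ , same-hybrids) w {k} k→w =
    count≤1⇒AtMostOne (λ e → proj₂ e ≟ w) (arc σ) (subst (_≤ 1) (indeg-orientAll-root σ w-root) w-tree) k→w
    where
    w-root : InRootComponent N w
    w-root = HasParentArc⇒root σ (k , k→w)
    w-tree : IsTreeNode (orientAll N σ) w
    w-tree = tree-node-resp-hybridEdges (orientAll N σ) N same-hybrids (root-tree w-root)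

  HeadInjective⇒rooted-partner : ∀ σ → HeadInjective σ → IsRootedPartnerOrientation N σ
  HeadInjective⇒rooted-partner σ inj = (refl , orientAll-acyclic σ) , ↭-reflexive same-hybrids
    where
    H? : Decidable (λ (e : Fin n × Fin n) → ¬ IsTreeNode (orientAll N σ) (proj₂ e))
    H? = Hybrid? (orientAll N σ)
    arc-heads-tree : ∀ {e} → e ∈ tabulate (arc σ) → ¬ ¬ IsTreeNode (orientAll N σ) (proj₂ e)
    arc-heads-tree e∈ hybrid with ∈-tabulate⁻ e∈
    ... | k , refl = hybrid (head-tree σ inj k)
    same-tree-nodes : (λ (e : Fin n × Fin n) → ¬ IsTreeNode (orientAll N σ) (proj₂ e)) ≐
                      (λ e → ¬ IsTreeNode N (proj₂ e))
    same-tree-nodes = (λ hyb t → hyb (tree⇒orientAll-tree σ inj t)) , (λ hyb t → hyb (orientAll-tree⇒tree σ t))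
    same-hybrids : hybridEdges (orientAll N σ) ≡ hybridEdges N
    same-hybrids = begin
      filter H? (ED N ++ tabulate (arc σ))           ≡⟨ filter-++ H? (ED N) (tabulate (arc σ)) ⟩
      filter H? (ED N) ++ filter H? (tabulate (arc σ))
        ≡⟨ cong (filter H? (ED N) ++_) (filter-none H? (All.tabulate arc-heads-tree)) ⟩
      filter H? (ED N) ++ []                         ≡⟨ ++-identityʳ _ ⟩
      filter H? (ED N)                               ≡⟨ filter-≐ H? (Hybrid? N) same-tree-nodes (ED N) ⟩
      hybridEdges N                                  ∎
      where open ≡-Reasoning

  -- Rerooting

  flip : Orientation → Fin (length (EU N)) → Orientation
  flip σ i k = if does (k ≟ i) then not (σ k) else σ k

  flipped-or-unchanged : ∀ σ i k → k ≡ i ⊎ (k ≢ i × arc (flip σ i) k ≡ arc σ k)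
  flipped-or-unchanged σ i k with k ≟ i
  ... | yes k≡i = inj₁ k≡i
  ... | no k≢i  = inj₂ (k≢i , refl)

  arc-flip-≡ : ∀ σ i → arc (flip σ i) i ≡ swap (arc σ i)
  arc-flip-≡ σ i rewrite dec-true (i ≟ i) refl = orientEdge-not (σ i) (edge i)

  source-arc : ∀ σ {a c} → Source σ a → ∀ i → Joins (edge i) a c → arc σ i ≡ (a , c)
  source-arc σ a-source i joins with orientEdge-Joins (σ i) joins
  ... | inj₁ a→c = a→c
  ... | inj₂ c→a = ⊥-elim (a-source (i , cong proj₂ c→a))

  flip-source : ∀ σ {a c} → HeadInjective σ → Source σ a → ∀ i → Joins (edge i) a c →
                HeadInjective (flip σ i) × Source (flip σ i) c × arc (flip σ i) i ≡ (c , a)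
  flip-source σ {a} {c} inj a-source i joins = inj′ , c-source′ , c→a
    where
    σ′ : Orientation
    σ′ = flip σ i
    a→c : arc σ i ≡ (a , c)
    a→c = source-arc σ a-source i joins
    c→a : arc σ′ i ≡ (c , a)
    c→a = trans (arc-flip-≡ σ i) (cong swap a→c)
    head′ : ∀ {k w} → head σ′ k ≡ w → (k ≡ i × a ≡ w) ⊎ (k ≢ i × head σ k ≡ w)
    head′ {k} k→w with flipped-or-unchanged σ i k
    ... | inj₁ refl              = inj₁ (refl , trans (sym (cong proj₂ c→a)) k→w)
    ... | inj₂ (k≢i , unchanged) = inj₂ (k≢i , trans (sym (cong proj₂ unchanged)) k→w)
    inj′ : HeadInjective σ′
    inj′ w {k} {l} k→w l→w with head′ {k} k→w | head′ {l} l→w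
    ... | inj₁ (k≡i , _)  | inj₁ (l≡i , _)  = trans k≡i (sym l≡i)
    ... | inj₁ (_ , a≡w)  | inj₂ (_ , l→w′) = ⊥-elim (a-source (l , trans l→w′ (sym a≡w)))
    ... | inj₂ (_ , k→w′) | inj₁ (_ , a≡w)  = ⊥-elim (a-source (k , trans k→w′ (sym a≡w)))
    ... | inj₂ (_ , k→w′) | inj₂ (_ , l→w′) = inj w k→w′ l→w′
    c-source′ : Source σ′ c
    c-source′ (k , k→c) with head′ {k} k→c
    ... | inj₁ (_ , a≡c)    = tail≢head σ i (trans (cong proj₁ a→c) (trans a≡c (sym (cong proj₂ a→c))))
    ... | inj₂ (k≢i , k→c′) = k≢i (inj c k→c′ (cong proj₂ a→c))

  reroot : ∀ σ {a b} → HeadInjective σ → Source σ a → Star UStep a b →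
           Σ Orientation λ σ′ → HeadInjective σ′ × Source σ′ b ×
             (∀ k → arc σ′ k ≡ arc σ k ⊎ proj₁ (edge k) ∼⟨ N ⟩ b)
  reroot σ inj a-source ε = σ , inj , a-source , λ _ → inj₁ refl
  reroot σ {b = b} inj a-source ((i , joins) ◅ p) with flip-source σ inj a-source i joins
  ... | inj′ , c-source′ , _ with reroot (flip σ i) inj′ c-source′ p
  ...   | σ″ , inj″ , b-source″ , changed = σ″ , inj″ , b-source″ , changed′
    where
    changed′ : ∀ k → arc σ″ k ≡ arc σ k ⊎ proj₁ (edge k) ∼⟨ N ⟩ b
    changed′ k with changed k | flipped-or-unchanged σ i k
    ... | inj₂ k∼b  | _                    = inj₂ k∼b
    ... | inj₁ same | inj₂ (_ , unchanged) = inj₁ (trans same unchanged)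
    ... | inj₁ _    | inj₁ refl            =
      inj₂ (proj₁ (Joins⇒endpoints (λ x → x ∼⟨ N ⟩ b) joins (undirected⇒∼ ((i , joins) ◅ p)) (undirected⇒∼ p)))

  data Descendant (σ : Orientation) (a : Fin n) : Fin n → Set where
    self  : Descendant σ a a
    child : ∀ {x z} k → arc σ k ≡ (x , z) → Descendant σ a x → Descendant σ a z

  descendant-parent : ∀ σ {a x z} → HeadInjective σ → Source σ a → ∀ k → arc σ k ≡ (z , x) →
                      Descendant σ a x → Descendant σ a z
  descendant-parent σ inj a-source k z→x self = ⊥-elim (a-source (k , cong proj₂ z→x))
  descendant-parent σ {a} inj a-source k z→x (child l y→x d) with inj _ (cong proj₂ z→x) (cong proj₂ y→x)
  ... | refl = subst (Descendant σ a) (trans (sym (cong proj₁ y→x)) (cong proj₁ z→x)) d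

  undirected-descendant : ∀ σ {a x b} → HeadInjective σ → Source σ a → Descendant σ a x →
                          Star UStep x b → Descendant σ a b
  undirected-descendant σ inj a-source d ε = d
  undirected-descendant σ inj a-source d ((k , joins) ◅ p) with orientEdge-Joins (σ k) joins
  ... | inj₁ x→z = undirected-descendant σ inj a-source (child k x→z d) p
  ... | inj₂ z→x = undirected-descendant σ inj a-source (descendant-parent σ inj a-source k z→x d) p

  reachable-from-source : ∀ σ {a b} → HeadInjective σ → Source σ a → Star UStep a b → b ≡ a ⊎ HasParentArc σ b
  reachable-from-source σ inj a-source p with undirected-descendant σ inj a-source self p
  ... | self          = inj₁ refl
  ... | child k x→b _ = inj₂ (k , cong proj₂ x→b)

  -- The climbed path stays simple, so it has at most n nodes and n steps of fuel suffice.
  source-above : ∀ σ u → ∃ λ a → Source σ a × Star (Arc σ) a u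
  source-above σ u = climb n u ε tt (m≤m+n n 1)
    where
    open DecMembership _≟_ using (_∈?_)
    climb : (fuel : ℕ) → ∀ z (p : Star (Arc σ) z u) → Simple p → n ≤ fuel + length (nodes p) →
            ∃ λ a → Source σ a × Star (Arc σ) a u
    climb fuel z p sp bound with any? (λ k → head σ k ≟ z)
    ... | no z-source = z , z-source , p
    ... | yes (k , k→z) with tail σ k ∈? nodes p
    ...   | yes tail∈p =
      let q , sq , _ = prefix p sp tail∈p
          parent = k , cong (tail σ k ,_) k→z
      in ⊥-elim (no-forward-cycle (Arc⇒Forward parent) (Star.map Arc⇒Forward q)
                   (subst (λ l → Unique (tail σ k ∷ l)) (sym (starts-map Arc⇒Forward q))
                          (close-Unique-starts parent q sq)))
    climb zero z p sp bound | yes (k , k→z) | no tail∉p =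
      ⊥-elim (<⇒≱ (s≤s bound)
                  (Unique⇒length≤ (Simple⇒Unique-nodes ((k , cong (tail σ k ,_) k→z) ◅ p) (tail∉p , sp))))
    climb (suc fuel) z p sp bound | yes (k , k→z) | no tail∉p =
      climb fuel _ ((k , cong (tail σ k ,_) k→z) ◅ p) (tail∉p , sp) (subst (n ≤_) (sym (+-suc fuel _)) bound)

  -- Blocked nodes

  udeg≡count : ∀ v → udeg N v ≡ count (λ e → (proj₁ e ≟ v) ⊎-dec (proj₂ e ≟ v)) (tabulate edge)
  udeg≡count v = cong (count _) (sym (tabulate-lookup (EU N)))

  udeg≡1⇒AtMostOne : ∀ {v} → udeg N v ≡ 1 → AtMostOne (λ k → Incident v (edge k))
  udeg≡1⇒AtMostOne {v} deg≡1 = count≤1⇒AtMostOne _ edge (≤-reflexive (trans (sym (udeg≡count v)) deg≡1))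

  udeg>0⇒Incident : ∀ {v} → 0 < udeg N v → ∃ λ k → Incident v (edge k)
  udeg>0⇒Incident {v} deg>0 = tabulate⁻ (count>0⇒Any _ {tabulate edge} (subst (0 <_) (udeg≡count v) deg>0))

  arc-tail∉VDP∪W₀ : ∀ σ k → ¬ (InVDP N (tail σ k) ⊎ InW₀ N (tail σ k))
  arc-tail∉VDP∪W₀ σ k (inj₁ not-root)      = not-root (tail-root σ k)
  arc-tail∉VDP∪W₀ σ k (inj₂ (_ , trivial)) = tail≢head σ k (sym (trivial (head σ k) (swap (tail∼head σ k))))

  isolated-root⇒W₀ : ∀ {v} → InRootComponent N v → (∀ k → ¬ Incident v (edge k)) → InW₀ N v
  isolated-root⇒W₀ {v} v-root isolated = v-root , trivial
    where
    trivial : ∀ w → w ∼⟨ N ⟩ v → w ≡ v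
    trivial w (v⇝w , w⇝v) with root-walk⇒undirected v-root v⇝w w⇝v
    ... | ε               = refl
    ... | (k , joins) ◅ _ = ⊥-elim (isolated k (Joins⇒Incident joins))

  open DecMembership (≡-dec (_≟_ {n}) (_≟_ {n})) using () renaming (_∈?_ to _∈ₑ?_)

  HasChild? : ∀ v → Dec (HasChild N v)
  HasChild? v = any? (λ w → (v , w) ∈ₑ? ED N)

  HasTreeChild? : ∀ v → Dec (HasTreeChild N v)
  HasTreeChild? v = any? (λ w → ((v , w) ∈ₑ? ED N) ×-dec (indeg N w ≤? 1))

  Blocked : Orientation → Fin n → Set
  Blocked σ v = HasParentArc σ v × ¬ HasChildArc σ v × ¬ HasTreeChild N v × HasChild N v

  Blocked? : ∀ σ v → Dec (Blocked σ v)
  Blocked? σ v = any? (λ k → head σ k ≟ v) ×-dec ¬? (any? (λ k → tail σ k ≟ v)) ×-dec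
                 ¬? (HasTreeChild? v) ×-dec HasChild? v

  blocked⇒¬tree-child : ∀ σ {v} → Blocked σ v → ¬ IsTreeChild (orientAll N σ)
  blocked⇒¬tree-child σ {v} (_ , no-child-arc , no-tree-child , (w , v→w)) tc with tc v (w , ∈-++⁺ˡ v→w)
  ... | w′ , v→w′ , w′-tree with orientAll-child⁻ σ v→w′
  ...   | inj₁ v→w′∈N   = no-tree-child (w′ , v→w′∈N , orientAll-tree⇒tree σ w′-tree)
  ...   | inj₂ (k , k→) = no-child-arc (k , cong proj₁ k→)

  tree-child⇒TreeChild-VDP∪W₀ : ∀ σ → IsTreeChild (orientAll N σ) → TreeChild-VDP∪W₀ N
  tree-child⇒TreeChild-VDP∪W₀ σ tc v v∈VDP∪W₀ (w , v→w) with tc v (w , ∈-++⁺ˡ v→w)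
  ... | w′ , v→w′ , w′-tree with orientAll-child⁻ σ v→w′
  ...   | inj₁ v→w′∈N   = w′ , v→w′∈N , orientAll-tree⇒tree σ w′-tree
  ...   | inj₂ (k , k→) =
    ⊥-elim (arc-tail∉VDP∪W₀ σ k (subst (λ x → InVDP N x ⊎ InW₀ N x) (sym (cong proj₁ k→)) v∈VDP∪W₀))

  TreeChild-VDP∪W₀⇒tree-child : ∀ σ → HeadInjective σ → TreeChild-VDP∪W₀ N → (∀ v → ¬ Blocked σ v) →
                                IsTreeChild (orientAll N σ)
  TreeChild-VDP∪W₀⇒tree-child σ inj tc unblocked v (w , v→w) with any? (λ k → tail σ k ≟ v)
  ... | yes (k , refl)  = head σ k , arc-child σ k , head-tree σ inj k
  ... | no no-child-arc with HasTreeChild? v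
  ...   | yes (w′ , v→w′ , w′-tree) = w′ , ∈-++⁺ˡ v→w′ , tree⇒orientAll-tree σ inj w′-tree
  ...   | no no-tree-child          = ⊥-elim (not-in-VDP not-root)
    where
    has-child : HasChild N v
    has-child with orientAll-child⁻ σ v→w
    ... | inj₁ v→w∈N   = w , v→w∈N
    ... | inj₂ (k , k→) = ⊥-elim (no-child-arc (k , cong proj₁ k→))
    not-in-VDP : ¬ InVDP N v
    not-in-VDP v∈VDP = no-tree-child (tc v (inj₁ v∈VDP) has-child)
    not-root : ¬ InRootComponent N v
    not-root v-root = no-tree-child (tc v (inj₂ (isolated-root⇒W₀ v-root isolated)) has-child)
      where
      isolated : ∀ k → ¬ Incident v (edge k)
      isolated k k-at-v with orientEdge-Incident⁺ (σ k) k-at-v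
      ... | inj₁ k-from-v = no-child-arc (k , k-from-v)
      ... | inj₂ k-into-v = unblocked v ((k , k-into-v) , no-child-arc , no-tree-child , has-child)

  W₁-root : ∀ {r u} → InRootComponent N r → InW₁ N r u → InRootComponent N u
  W₁-root r-root ((r⇝u , u⇝r) , _) = root-closed r-root u⇝r r⇝u

  blocked⇒W₁ : ∀ σ {v r} → HeadInjective σ → Blocked σ v → v ∼⟨ N ⟩ r → InW₁ N r v
  blocked⇒W₁ σ {v} inj ((k , k→v) , no-child-arc , no-tree-child , (w , v→w)) v∼r =
    v∼r , (w , inj₁ v→w , λ w-root → root-no-parent w-root v→w) , ≤-antisym udeg≤1 udeg≥1 , no-tree-child
    where
    into-v : ∀ {l} → Incident v (edge l) → head σ l ≡ v
    into-v {l} l-at-v with orientEdge-Incident⁺ (σ l) l-at-v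
    ... | inj₁ l-from-v = ⊥-elim (no-child-arc (l , l-from-v))
    ... | inj₂ l-into-v = l-into-v
    udeg≤1 : udeg N v ≤ 1
    udeg≤1 = subst (_≤ 1) (sym (udeg≡count v))
               (AtMostOne⇒count≤1 _ edge (λ k-at-v l-at-v → inj v (into-v k-at-v) (into-v l-at-v)))
    udeg≥1 : 1 ≤ udeg N v
    udeg≥1 = subst (0 <_) (sym (udeg≡count v))
               (filter-some _ (tabulate⁺ k (orientEdge-Incident (σ k) (inj₂ k→v))))

  W₁⇒blocked : ∀ σ {r u} → InRootComponent N r → InW₁ N r u → HasParentArc σ u → Blocked σ u
  W₁⇒blocked σ {u = u} r-root u∈W₁@(_ , (w , u-w , w∈VDP) , deg≡1 , no-tree-child) (k , k→u) =
    (k , k→u) , no-child-arc , no-tree-child , has-child u-w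
    where
    no-child-arc : ¬ HasChildArc σ u
    no-child-arc (l , l-from-u)
      with udeg≡1⇒AtMostOne deg≡1 (orientEdge-Incident (σ l) (inj₁ l-from-u))
                                  (orientEdge-Incident (σ k) (inj₂ k→u))
    ... | refl = tail≢head σ k (trans l-from-u (sym k→u))
    has-child : Adjacent N u w → HasChild N u
    has-child (inj₁ u→w)               = w , u→w
    has-child (inj₂ (inj₁ w→u))        = ⊥-elim (root-no-parent (W₁-root r-root u∈W₁) w→u)
    has-child (inj₂ (inj₂ (inj₁ u-w))) = ⊥-elim (w∈VDP (proj₁ (proj₂ (complete _ _ u-w))))
    has-child (inj₂ (inj₂ (inj₂ w-u))) = ⊥-elim (w∈VDP (proj₁ (complete _ _ w-u)))

  -- Rerooting the component of a blocked node u at u changes only arcs between nodes ∼ u, and by |W₁| ≤ 1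
  -- no node ∼ u other than u can be blocked afterwards.
  unblock : W₁-AtMostOne N → ∀ σ {u} → HeadInjective σ → Blocked σ u →
            Σ Orientation λ σ′ → HeadInjective σ′ × (∀ {v} → Blocked σ′ v → Blocked σ v) × ¬ Blocked σ′ u
  unblock at-most-one σ {u} inj u-blocked with source-above σ u
  ... | a , a-source , a⇝u with reroot σ inj a-source (Star.map Arc⇒UStep a⇝u)
  ...   | σ′ , inj′ , u-source′ , changed = σ′ , inj′ , still-blocked , u-source′ ∘ proj₁
    where
    still-blocked : ∀ {v} → Blocked σ′ v → Blocked σ v
    still-blocked {v} v-blocked′@((k , k→v) , no-child-arc′ , rest) = (k , head-same k→v) , no-child-arc , rest
      where
      v≁u : ¬ v ∼⟨ N ⟩ u
      v≁u v∼u with at-most-one u (HasParentArc⇒root σ (proj₁ u-blocked)) u v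
                     (blocked⇒W₁ σ inj u-blocked (ε , ε)) (blocked⇒W₁ σ′ inj′ v-blocked′ v∼u)
      ... | refl = u-source′ (k , k→v)
      unchanged : ∀ {l} → Incident v (edge l) → arc σ′ l ≡ arc σ l
      unchanged {l} l-at-v with changed l
      ... | inj₁ same = same
      ... | inj₂ l∼u  = ⊥-elim (v≁u (Incident-∼ l-at-v l∼u))
      head-same : ∀ {l} → head σ′ l ≡ v → head σ l ≡ v
      head-same {l} l→v = trans (sym (cong proj₂ (unchanged (orientEdge-Incident (σ′ l) (inj₂ l→v))))) l→v
      no-child-arc : ¬ HasChildArc σ v
      no-child-arc (l , l-from-v) =
        no-child-arc′ (l , trans (cong proj₁ (unchanged (orientEdge-Incident (σ l) (inj₁ l-from-v)))) l-from-v)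

  unblock-all : W₁-AtMostOne N → (us : List (Fin n)) → ∀ σ → HeadInjective σ →
                Σ Orientation λ σ′ → HeadInjective σ′ × (∀ {v} → Blocked σ′ v → Blocked σ v) ×
                  All (λ v → ¬ Blocked σ′ v) us
  unblock-all _ [] σ inj = σ , inj , id , []
  unblock-all at-most-one (u ∷ us) σ inj with unblock-all at-most-one us σ inj
  ... | σ₁ , inj-σ₁ , mono₁ , rest with Blocked? σ₁ u
  ...   | no u-unblocked = σ₁ , inj-σ₁ , mono₁ , u-unblocked ∷ rest
  ...   | yes u-blocked with unblock at-most-one σ₁ inj-σ₁ u-blocked
  ...     | σ₂ , inj-σ₂ , mono₂ , u-unblocked =
    σ₂ , inj-σ₂ , mono₁ ∘ mono₂ , u-unblocked ∷ All.map (_∘ mono₂) rest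

  tree-child⇒W₁-AtMostOne : ∀ σ → HeadInjective σ → IsTreeChild (orientAll N σ) → W₁-AtMostOne N
  tree-child⇒W₁-AtMostOne σ inj tc r r-root u u′ u∈W₁ u′∈W₁ =
    [ sym , ⊥-elim ∘ W₁-source u′∈W₁ ]′ (reachable-from-source σ inj (W₁-source u∈W₁) u⇝u′)
    where
    W₁-source : ∀ {x} → InW₁ N r x → Source σ x
    W₁-source x∈W₁ parent = blocked⇒¬tree-child σ (W₁⇒blocked σ r-root x∈W₁ parent) tc
    u∼u′ : u ∼⟨ N ⟩ u′
    u∼u′ = ∼-trans (proj₁ u∈W₁) (swap (proj₁ u′∈W₁))
    u⇝u′ : Star UStep u u′
    u⇝u′ = root-walk⇒undirected (W₁-root r-root u∈W₁) (proj₂ u∼u′) (proj₁ u∼u′)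

  weakly⇒conditions : WeaklyTreeChild N → TreeChild-VDP∪W₀ N × W₁-AtMostOne N
  weakly⇒conditions (σ , partner , tc) =
    tree-child⇒TreeChild-VDP∪W₀ σ tc , tree-child⇒W₁-AtMostOne σ (rooted-partner⇒HeadInjective σ partner) tc

  conditions⇒weakly : ∀ σ₀ → HeadInjective σ₀ → TreeChild-VDP∪W₀ N × W₁-AtMostOne N → WeaklyTreeChild N
  conditions⇒weakly σ₀ inj₀ (tc , at-most-one) =
    let σ , inj , _ , unblocked = unblock-all at-most-one (allFin n) σ₀ inj₀
    in σ , HeadInjective⇒rooted-partner σ inj ,
       TreeChild-VDP∪W₀⇒tree-child σ inj tc (λ v → All.lookup unblocked (∈-allFin v))

  strongly⇒W₁-orphan : StronglyTreeChild N → ∀ {r u} → InRootComponent N r → InW₁ N r u →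
                       ∀ σ → HeadInjective σ → ¬ HasParentArc σ u
  strongly⇒W₁-orphan strongly r-root u∈W₁ σ inj parent =
    blocked⇒¬tree-child σ (W₁⇒blocked σ r-root u∈W₁ parent) (strongly σ (HeadInjective⇒rooted-partner σ inj))

  strongly⇒W₁-Empty : ∀ σ → HeadInjective σ → StronglyTreeChild N → W₁-Empty N
  strongly⇒W₁-Empty σ inj strongly r r-root u u∈W₁@(_ , _ , deg≡1 , _) =
    let k , k-at-u       = udeg>0⇒Incident (≤-reflexive (sym deg≡1))
        _ , joins        = Incident⇒Joins k-at-u
        inj′ , _ , c→u   = flip-source σ inj (orphan σ inj) k joins
    in orphan (flip σ k) inj′ (k , cong proj₂ c→u)
    where
    orphan : ∀ σ′ → HeadInjective σ′ → ¬ HasParentArc σ′ u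
    orphan = strongly⇒W₁-orphan strongly r-root u∈W₁

  strongly⇒conditions : ∀ σ₀ → HeadInjective σ₀ → StronglyTreeChild N → TreeChild-VDP∪W₀ N × W₁-Empty N
  strongly⇒conditions σ₀ inj₀ strongly =
    tree-child⇒TreeChild-VDP∪W₀ σ₀ (strongly σ₀ (HeadInjective⇒rooted-partner σ₀ inj₀)) ,
    strongly⇒W₁-Empty σ₀ inj₀ strongly

  conditions⇒strongly : TreeChild-VDP∪W₀ N × W₁-Empty N → StronglyTreeChild N
  conditions⇒strongly (tc , empty) σ partner = TreeChild-VDP∪W₀⇒tree-child σ inj tc λ v v-blocked →
    empty v (HasParentArc⇒root σ (proj₁ v-blocked)) v (blocked⇒W₁ σ inj v-blocked (ε , ε))
    where
    inj : HeadInjective σ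
    inj = rooted-partner⇒HeadInjective σ partner

proposition9 : ∀ {n : ℕ} (N : SDG n) → IsNetwork N → Complete N →
      (WeaklyTreeChild N ⇔
        ((∀ v → InVDP N v ⊎ InW₀ N v → HasChild N v → HasTreeChild N v) ×
         (∀ r → InRootComponent N r → ∀ u u′ → InW₁ N r u → InW₁ N r u′ → u ≡ u′)))
    × (StronglyTreeChild N ⇔
        ((∀ v → InVDP N v ⊎ InW₀ N v → HasChild N v → HasTreeChild N v) ×
         (∀ r → InRootComponent N r → ∀ u → ¬ InW₁ N r u)))
proposition9 N ((no-loops , _) , acyclic , σ₀ , partner₀) complete =
  mk⇔ weakly⇒conditions (conditions⇒weakly σ₀ inj₀) ,
  mk⇔ (strongly⇒conditions σ₀ inj₀) conditions⇒strongly
  where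
  open Network N no-loops acyclic complete
  inj₀ : HeadInjective σ₀
  inj₀ = rooted-partner⇒HeadInjective σ₀ partner₀
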